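{- For every $\ell\ge 3$ and every $n\ge \ell$, \(\widehat P^{(3)}(n,\ell)\subsetneq DI(n,\ell)\). When $n<\ell$, both ideals are the whole polynomial ring. Thus the strict containment holds precisely in the non-vacuous range.
   Context: Let $\mathbf{k}$ be a field of characteristic zero and $S_n=\mathbf{k}[x_1,\ldots,x_n]$. For a 3-graph $G$ with vertex set contained in $[n]$, define $p_G=\prod_{1\le i<j<k\le n,\ ijk\notin G}(x_i-x_j)(x_i-x_k)(x_j-x_k)$. Let $I(n,\ell)\subset S_n$ be the ideal of polynomials that vanish after the identification of any $\ell$ variables (i.e. on every diagonal $x_{i_1}=\cdots=x_{i_\ell}$). Define $DI(n,\ell)=\{p\in S_n: \partial^j p/\partial x_i^j\in I(n,\ell)$ for every $i\in[n]$ and every $0\le j\le n-3\}$. Let $\widehat P^{(3)}(n,\ell)$ be the ideal of $S_n$ generated by the polynomials $p_G$ with $G$ ranging over all $(\ell-1)$-partite 3-graphs with vertex set contained in $[n]$. -}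

module Defs where

open import Level using (Level; _⊔_)
open import Algebra.Bundles using (CommutativeRing)
open import Data.Nat as ℕ using (ℕ; zero; suc; _≤_; _<_)
open import Data.Nat.Properties as ℕP using ()
open import Data.Fin as Fin using (Fin; toℕ)
open import Data.Vec as Vec using (Vec; lookup; updateAt; replicate)
open import Data.Vec.Properties using (≡-dec)
open import Data.List as List using (List; []; _∷_; _++_; concatMap; allFin; filter; foldr)
open import Data.Product using (Σ; ∃; _×_; _,_; proj₁; proj₂)
open import Data.Bool using (Bool; true; false)
open import Relation.Nullary using (¬_; Dec; yes; no)
open import Relation.Binary.PropositionalEquality using (_≡_)
open import Data.Unit using (⊤)

record IsField {c ℓ : Level} (R : CommutativeRing c ℓ) : Set (c ⊔ ℓ) where
  open CommutativeRing R
  field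
    0≉1 : ¬ (0# ≈ 1#)
    inverse : ∀ x → ¬ (x ≈ 0#) → ∃ λ y → x * y ≈ 1#

module _ {c ℓ : Level} (R : CommutativeRing c ℓ) where
  open CommutativeRing R

  natCast : ℕ → Carrier
  natCast zero = 0#
  natCast (suc m) = 1# + natCast m

  CharZero : Set ℓ
  CharZero = ∀ m → ¬ (natCast (suc m) ≈ 0#)

-- Polynomials in n variables over R, in sparse form: a finite list of
-- terms  c · x^e  (c a coefficient, e an exponent vector).  Two such
-- lists denote the same polynomial iff all their coefficients agree.

module Poly {c ℓ : Level} (R : CommutativeRing c ℓ) where
  open CommutativeRing R

  Monomial : ℕ → Set
  Monomial n = Vec ℕ n

  Term : ℕ → Set c
  Term n = Carrier × Monomial n

  Pol : ℕ → Set c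
  Pol n = List (Term n)

  coeff : ∀ {n} → Pol n → Monomial n → Carrier
  coeff [] e = 0#
  coeff ((a , f) ∷ p) e with ≡-dec ℕ._≟_ f e
  ... | yes _ = a + coeff p e
  ... | no  _ = coeff p e

  _≈ₚ_ : ∀ {n} → Pol n → Pol n → Set ℓ
  p ≈ₚ q = ∀ e → coeff p e ≈ coeff q e

  0ₚ : ∀ {n} → Pol n
  0ₚ = []

  1ₚ : ∀ {n} → Pol n
  1ₚ = (1# , replicate _ 0) ∷ []

  const : ∀ {n} → Carrier → Pol n
  const a = (a , replicate _ 0) ∷ []

  var : ∀ {n} → Fin n → Pol n
  var i = (1# , updateAt (replicate _ 0) i (λ _ → 1)) ∷ []

  _+ₚ_ : ∀ {n} → Pol n → Pol n → Pol n
  p +ₚ q = p ++ q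

  -ₚ_ : ∀ {n} → Pol n → Pol n
  -ₚ p = List.map (λ { (a , e) → (- a , e) }) p

  _-ₚ_ : ∀ {n} → Pol n → Pol n → Pol n
  p -ₚ q = p +ₚ (-ₚ q)

  _*ₚ_ : ∀ {n} → Pol n → Pol n → Pol n
  p *ₚ q = concatMap (λ { (a , e) → List.map (λ { (b , f) → (a * b , Vec.zipWith ℕ._+_ e f) }) q }) p

  prodₚ : ∀ {n} → List (Pol n) → Pol n
  prodₚ = foldr _*ₚ_ 1ₚ

  sumₚ : ∀ {n} → List (Pol n) → Pol n
  sumₚ = foldr _+ₚ_ 0ₚ

  _^_ : Carrier → ℕ → Carrier
  a ^ zero = 1#
  a ^ suc m = a * (a ^ m)

  evalMon : ∀ {n} → Monomial n → (Fin n → Carrier) → Carrier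
  evalMon {n} e x = foldr _*_ 1# (List.map (λ v → x v ^ lookup e v) (allFin n))

  eval : ∀ {n} → Pol n → (Fin n → Carrier) → Carrier
  eval [] x = 0#
  eval ((a , e) ∷ p) x = a * evalMon e x + eval p x

  ∂ : ∀ {n} → Fin n → Pol n → Pol n
  ∂ i [] = []
  ∂ i ((a , e) ∷ p) with lookup e i
  ... | zero  = ∂ i p
  ... | suc m = (natCast R (suc m) * a , updateAt e i (λ _ → m)) ∷ ∂ i p

  ∂^ : ∀ {n} → ℕ → Fin n → Pol n → Pol n
  ∂^ zero i p = p
  ∂^ (suc j) i p = ∂ i (∂^ j i p)

  Injective : ∀ {a b} → (Fin a → Fin b) → Set
  Injective f = ∀ u v → f u ≡ f v → u ≡ v

  I : (n l : ℕ) → Pol n → Set (c ⊔ ℓ)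
  I n l p = (ι : Fin l → Fin n) → Injective ι →
            (x : Fin n → Carrier) → (∀ u v → x (ι u) ≈ x (ι v)) →
            eval p x ≈ 0#

  DI : (n l : ℕ) → Pol n → Set (c ⊔ ℓ)
  DI n l p = (i : Fin n) → (j : ℕ) → j ℕ.+ 3 ≤ n → I n l (∂^ j i p)

  -- 3-graphs on [n]: an edge set, given by its indicator on triples
  -- i < j < k (the value on other triples is irrelevant).

  record ThreeGraph (n : ℕ) : Set where
    field
      edge : Fin n → Fin n → Fin n → Bool

  triples : (n : ℕ) → List (Fin n × Fin n × Fin n)
  triples n =
    concatMap (λ i → concatMap (λ j → concatMap (λ k → pick i j k) (allFin n)) (allFin n)) (allFin n)
    where
    pick : Fin n → Fin n → Fin n → List (Fin n × Fin n × Fin n)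
    pick i j k with toℕ i ℕ.<? toℕ j | toℕ j ℕ.<? toℕ k
    ... | yes _ | yes _ = (i , j , k) ∷ []
    ... | _     | _     = []

  factor : ∀ {n} → Fin n × Fin n × Fin n → Pol n
  factor (i , j , k) = ((var i -ₚ var j) *ₚ (var i -ₚ var k)) *ₚ (var j -ₚ var k)

  pG : ∀ {n} → ThreeGraph n → Pol n
  pG {n} G = prodₚ (concatMap sel (triples n))
    where
    sel : Fin n × Fin n × Fin n → List (Pol n)
    sel (i , j , k) with ThreeGraph.edge G i j k
    ... | true  = []
    ... | false = factor (i , j , k) ∷ []

  IsPartite : ∀ {n} → ℕ → ThreeGraph n → Set
  IsPartite {n} m G =
    Σ (Fin n → Fin m) λ col →
      ∀ i j k → toℕ i < toℕ j → toℕ j < toℕ k →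
        ThreeGraph.edge G i j k ≡ true →
        ¬ (col i ≡ col j) × ¬ (col i ≡ col k) × ¬ (col j ≡ col k)

  PartiteGraph : ℕ → ℕ → Set
  PartiteGraph n m = Σ (ThreeGraph n) (IsPartite m)

  Phat : (n l : ℕ) → Pol n → Set (c ⊔ ℓ)
  Phat n l p =
    Σ (List (Pol n × PartiteGraph n (l ℕ.∸ 1))) λ combo →
      p ≈ₚ sumₚ (List.map (λ { (a , G) → a *ₚ pG (proj₁ G) }) combo)

-- Containment: among any ℓ vertices two share one of the ℓ - 1 colours of an (ℓ-1)-partite 3-graph G,
-- so with any third vertex they span a non-edge, and p_G has the factor (x_a - x_b)(x_a - x_c)(x_b - x_c)
-- with a, b, c among them.  On the diagonal through these ℓ variables one of its three linear factors
-- does not involve x_i and vanishes, so by the Leibniz rule every multiple of p_G vanishes there to every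
-- order in the direction of x_i.
-- Strictness: s = ∏_{a ≥ ℓ-1, b ≠ a} (x_a - x_b)^(n-2) lies in DI(n,ℓ), since every diagonal through ℓ
-- distinct variables contains some x_a with a ≥ ℓ-1, and (x_a - x_b)^(n-2) vanishes there to order n - 2.
-- At z = (0, …, 0, 1, 2, …) with ℓ - 1 zeros every such p_G vanishes (take the vertices 0, …, ℓ-1 above:
-- two of any three of them are zero coordinates of z), whereas over a field of characteristic zero the
-- coordinates z_a, a ≥ ℓ-1, are distinct and nonzero, so s(z) ≠ 0.
-- For n < ℓ, DI(n,ℓ) imposes no condition and the complete 3-graph is (ℓ-1)-partite with p_G = 1.
module Submission where

open import Level using (Level)
open import Algebra.Bundles using (CommutativeRing)
open import Data.Bool using (true; false)
open import Data.Fin as Fin using (Fin; toℕ)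
import Data.Fin.Properties as Fin
open import Data.List as List
  using (List; []; _∷_; _++_; [_]; concatMap; allFin; filter; length; cartesianProduct)
import Data.List.Properties as List
open import Data.List.Membership.Propositional using (_∈_; lose)
open import Data.List.Membership.Propositional.Properties
  using (∈-allFin; ∈-concatMap⁺; ∈-map⁺; ∈-filter⁺; ∈-filter⁻; ∈-cartesianProduct⁺)
open import Data.List.Relation.Unary.All as All using (All)
import Data.List.Relation.Unary.All.Properties as All
open import Data.List.Relation.Unary.Any using (Any; here; there)
open import Data.Nat as ℕ using (ℕ; zero; suc; _≤_; _<_; _∸_; z≤n; s≤s)
import Data.Nat.Properties as ℕ
open import Data.Product using (Σ; ∃; _×_; _,_; proj₁; proj₂)
open import Data.Sum using (_⊎_; inj₁; inj₂)
open import Data.Vec as Vec using (lookup; updateAt; replicate)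
import Data.Vec.Properties as Vec
open import Function using (_∘_; id)
open import Relation.Binary.Bundles using (Setoid)
open import Relation.Binary.Definitions using (tri<; tri≈; tri>)
open import Relation.Binary.PropositionalEquality as ≡ using (_≡_; _≢_; refl; cong)
import Relation.Binary.Reasoning.Setoid
open import Relation.Nullary using (¬_; Dec; yes; no; ¬?; contradiction; _×-dec_)
open import Relation.Unary using (Decidable)

open import Defs

module _ {c ℓ : Level} (R : CommutativeRing c ℓ) where
  open CommutativeRing R hiding (zero) renaming (refl to ≈-refl; sym to ≈-sym; trans to ≈-trans)
  open Poly R
  module ≈-Reasoning = Relation.Binary.Reasoning.Setoid setoid
  open import Algebra.Properties.Ring ring using (-‿distribˡ-*)
  open import Algebra.Properties.AbelianGroup +-abelianGroup
    using (⁻¹-∙-comm; ε⁻¹≈ε; x≈y⇒x∙y⁻¹≈ε; x∙y⁻¹≈ε⇒x≈y; ∙-cancelˡ)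
  open import Algebra.Properties.CommutativeSemigroup +-commutativeSemigroup
    using () renaming (interchange to +-interchange; x∙yz≈y∙xz to +-x∙yz≈y∙xz)
  open import Algebra.Properties.CommutativeSemigroup *-commutativeSemigroup
    using () renaming (interchange to *-interchange; x∙yz≈y∙xz to *-x∙yz≈y∙xz)
  open import Algebra.Properties.CommutativeMonoid.Sum *-commutativeMonoid
    using () renaming (sum to ∏; sum-cong-≋ to ∏-cong; ∑-distrib-+ to ∏-distrib-*; sum-replicate-zero to ∏-1#)

  infix 4 _≟ₘ_
  _≟ₘ_ : ∀ {n} (e f : Monomial n) → Dec (e ≡ f)
  _≟ₘ_ = Vec.≡-dec ℕ._≟_

  coeff-∷-≡ : ∀ {n} a {f e : Monomial n} p → f ≡ e → coeff ((a , f) ∷ p) e ≈ a + coeff p e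
  coeff-∷-≡ a {f} {e} p f≡e with f ≟ₘ e
  ... | yes _  = ≈-refl
  ... | no f≢e = contradiction f≡e f≢e

  coeff-∷-≢ : ∀ {n} a {f e : Monomial n} p → f ≢ e → coeff ((a , f) ∷ p) e ≈ coeff p e
  coeff-∷-≢ a {f} {e} p f≢e with f ≟ₘ e
  ... | yes f≡e = contradiction f≡e f≢e
  ... | no _    = ≈-refl

  coeff-++ : ∀ {n} (p q : Pol n) e → coeff (p ++ q) e ≈ coeff p e + coeff q e
  coeff-++ []            q e = ≈-sym (+-identityˡ _)
  coeff-++ ((a , f) ∷ p) q e with f ≟ₘ e
  ... | yes _ = ≈-trans (+-congˡ (coeff-++ p q e)) (≈-sym (+-assoc _ _ _))
  ... | no _  = coeff-++ p q e

  coeff--ₚ : ∀ {n} (p : Pol n) e → coeff (-ₚ p) e ≈ - coeff p e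
  coeff--ₚ []            e = ≈-sym ε⁻¹≈ε
  coeff--ₚ ((a , f) ∷ p) e with f ≟ₘ e
  ... | yes _ = ≈-trans (+-congˡ (coeff--ₚ p e)) (⁻¹-∙-comm a (coeff p e))
  ... | no _  = coeff--ₚ p e

  -- A record around _≈ₚ_, so that both polynomials can be inferred from a proof.
  infix 4 _≋_
  record _≋_ {n} (p q : Pol n) : Set ℓ where
    constructor mk≋
    field pointwise : p ≈ₚ q
  open _≋_

  ≋-setoid : ℕ → Setoid c ℓ
  ≋-setoid n = record
    { Carrier       = Pol n
    ; _≈_           = _≋_
    ; isEquivalence = record
      { refl  = mk≋ λ _ → ≈-refl
      ; sym   = λ (mk≋ p≈q) → mk≋ λ e → ≈-sym (p≈q e)
      ; trans = λ (mk≋ p≈q) (mk≋ q≈r) → mk≋ λ e → ≈-trans (p≈q e) (q≈r e)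
      }
    }

  module ≋-Reasoning {n} = Relation.Binary.Reasoning.Setoid (≋-setoid n)

  module _ {n : ℕ} where
    open Setoid (≋-setoid n) public using () renaming (refl to ≋-refl; sym to ≋-sym; reflexive to ≡⇒≋)

  module _ {n} (x : Fin n → Carrier) where

    eval-++ : ∀ (p q : Pol n) → eval (p ++ q) x ≈ eval p x + eval q x
    eval-++ []            q = ≈-sym (+-identityˡ _)
    eval-++ ((a , f) ∷ p) q = ≈-trans (+-congˡ (eval-++ p q)) (≈-sym (+-assoc _ _ _))

    eval--ₚ : ∀ (p : Pol n) → eval (-ₚ p) x ≈ - eval p x
    eval--ₚ []            = ≈-sym ε⁻¹≈ε
    eval--ₚ ((a , f) ∷ p) =
      ≈-trans (+-cong (≈-sym (-‿distribˡ-* a (evalMon f x))) (eval--ₚ p)) (⁻¹-∙-comm _ _)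

    private
      withMonomial withoutMonomial : Monomial n → Pol n → Pol n
      withMonomial    f = filter (λ t → proj₂ t ≟ₘ f)
      withoutMonomial f = filter (λ t → ¬? (proj₂ t ≟ₘ f))

      eval-split : ∀ f (p : Pol n) →
                   eval p x ≈ eval (withMonomial f p) x + eval (withoutMonomial f p) x
      eval-split f []            = ≈-sym (+-identityˡ _)
      eval-split f ((a , g) ∷ p) with g ≟ₘ f
      ... | yes _ = ≈-trans (+-congˡ (eval-split f p)) (≈-sym (+-assoc _ _ _))
      ... | no _  = ≈-trans (+-congˡ (eval-split f p)) (+-x∙yz≈y∙xz _ _ _)

      eval-withMonomial : ∀ f (p : Pol n) → eval (withMonomial f p) x ≈ coeff p f * evalMon f x
      eval-withMonomial f []            = ≈-sym (zeroˡ _)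
      eval-withMonomial f ((a , g) ∷ p) with g ≟ₘ f
      ... | yes refl = ≈-trans (+-congˡ (eval-withMonomial f p)) (≈-sym (distribʳ _ _ _))
      ... | no _     = eval-withMonomial f p

      coeff-withoutMonomial : ∀ f (p : Pol n) e → e ≢ f → coeff (withoutMonomial f p) e ≈ coeff p e
      coeff-withoutMonomial f []            e e≢f = ≈-refl
      coeff-withoutMonomial f ((a , g) ∷ p) e e≢f with g ≟ₘ f
      ... | yes refl = ≈-trans (coeff-withoutMonomial f p e e≢f) (≈-sym (coeff-∷-≢ a p (e≢f ∘ ≡.sym)))
      ... | no _ with g ≟ₘ e
      ...   | yes _ = +-congˡ (coeff-withoutMonomial f p e e≢f)
      ...   | no _  = coeff-withoutMonomial f p e e≢f

      coeff-withoutMonomial-self : ∀ f (p : Pol n) → coeff (withoutMonomial f p) f ≈ 0#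
      coeff-withoutMonomial-self f []            = ≈-refl
      coeff-withoutMonomial-self f ((a , g) ∷ p) with g ≟ₘ f
      ... | yes _   = coeff-withoutMonomial-self f p
      ... | no g≢f  = ≈-trans (coeff-∷-≢ a (withoutMonomial f p) g≢f) (coeff-withoutMonomial-self f p)

      -- Induction on the length: all terms with the monomial of the head term are removed at once.
      eval-zero-≤ : ∀ k (p : Pol n) → length p ≤ k → (∀ e → coeff p e ≈ 0#) → eval p x ≈ 0#
      eval-zero-≤ _       []            _            _     = ≈-refl
      eval-zero-≤ (suc k) ((a , f) ∷ p) (s≤s |p|≤k) coeff≈0 = begin
        a * evalMon f x + eval p x
          ≈⟨ +-congˡ (eval-split f p) ⟩
        a * evalMon f x + (eval (withMonomial f p) x + eval (withoutMonomial f p) x)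
          ≈⟨ +-congˡ (+-cong (eval-withMonomial f p) rest≈0) ⟩
        a * evalMon f x + (coeff p f * evalMon f x + 0#)
          ≈⟨ +-congˡ (+-identityʳ _) ⟩
        a * evalMon f x + coeff p f * evalMon f x
          ≈⟨ ≈-sym (distribʳ _ _ _) ⟩
        (a + coeff p f) * evalMon f x
          ≈⟨ *-congʳ (≈-trans (≈-sym (coeff-∷-≡ a p refl)) (coeff≈0 f)) ⟩
        0# * evalMon f x
          ≈⟨ zeroˡ _ ⟩
        0# ∎
        where
        open ≈-Reasoning
        coeff-rest≈0 : ∀ e → coeff (withoutMonomial f p) e ≈ 0#
        coeff-rest≈0 e with e ≟ₘ f
        ... | yes refl = coeff-withoutMonomial-self f p
        ... | no e≢f   = ≈-trans (coeff-withoutMonomial f p e e≢f)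
                           (≈-trans (≈-sym (coeff-∷-≢ a p (e≢f ∘ ≡.sym))) (coeff≈0 e))
        rest≈0 : eval (withoutMonomial f p) x ≈ 0#
        rest≈0 = eval-zero-≤ k (withoutMonomial f p) (ℕ.≤-trans (List.length-filter _ p) |p|≤k) coeff-rest≈0

    eval-zero : ∀ (p : Pol n) → (∀ e → coeff p e ≈ 0#) → eval p x ≈ 0#
    eval-zero p = eval-zero-≤ (length p) p ℕ.≤-refl

    eval-cong : ∀ {p q : Pol n} → p ≋ q → eval p x ≈ eval q x
    eval-cong {p} {q} (mk≋ p≈q) = x∙y⁻¹≈ε⇒x≈y _ _ (begin
      eval p x - eval q x           ≈⟨ +-congˡ (≈-sym (eval--ₚ q)) ⟩
      eval p x + eval (-ₚ q) x      ≈⟨ ≈-sym (eval-++ p (-ₚ q)) ⟩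
      eval (p -ₚ q) x               ≈⟨ eval-zero (p -ₚ q) coeff≈0 ⟩
      0#                            ∎)
      where
      open ≈-Reasoning
      coeff≈0 : ∀ e → coeff (p -ₚ q) e ≈ 0#
      coeff≈0 e = ≈-trans (coeff-++ p (-ₚ q) e) (≈-trans (+-cong (p≈q e) (coeff--ₚ q e)) (-‿inverseʳ _))

  _+ₘ_ : ∀ {n} → Monomial n → Monomial n → Monomial n
  _+ₘ_ = Vec.zipWith ℕ._+_

  unit : ∀ {n} → Fin n → Monomial n
  unit a = updateAt (replicate _ 0) a (λ _ → 1)

  lookup-unit-≢ : ∀ {n} {a v : Fin n} → v ≢ a → lookup (unit a) v ≡ 0
  lookup-unit-≢ {n} {a} {v} v≢a = ≡.trans (Vec.lookup∘updateAt′ v a v≢a (replicate n 0)) (Vec.lookup-replicate v 0)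

  ^-+ : ∀ a m k → a ^ (m ℕ.+ k) ≈ a ^ m * a ^ k
  ^-+ a zero    k = ≈-sym (*-identityˡ _)
  ^-+ a (suc m) k = ≈-trans (*-congˡ (^-+ a m k)) (≈-sym (*-assoc _ _ _))

  ∏-δ : ∀ {n} (g : Fin n → Carrier) a → (∀ v → v ≢ a → g v ≈ 1#) → ∏ g ≈ g a
  ∏-δ {suc n} g Fin.zero    g≈1 =
    ≈-trans (*-congˡ (≈-trans (∏-cong (λ v → g≈1 (Fin.suc v) λ ())) (∏-1# n))) (*-identityʳ _)
  ∏-δ {suc n} g (Fin.suc a) g≈1 =
    ≈-trans (*-cong (g≈1 Fin.zero λ ()) (∏-δ (g ∘ Fin.suc) a (λ v v≢a → g≈1 (Fin.suc v) (v≢a ∘ Fin.suc-injective))))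
            (*-identityˡ _)

  *ₚ-∷ : ∀ {n} (t : Term n) (p q : Pol n) → (t ∷ p) *ₚ q ≡ ([ t ] *ₚ q) ++ (p *ₚ q)
  *ₚ-∷ (a , e) p q = cong (_++ (p *ₚ q)) (≡.sym (List.++-identityʳ _))

  foldr-tabulate : ∀ {n} (g : Fin n → Carrier) → List.foldr _*_ 1# (List.tabulate g) ≡ ∏ g
  foldr-tabulate {zero}  g = refl
  foldr-tabulate {suc n} g = cong (g Fin.zero *_) (foldr-tabulate (g ∘ Fin.suc))

  module _ {n} (x : Fin n → Carrier) where

    evalMon≡∏ : ∀ (e : Monomial n) → evalMon e x ≡ ∏ (λ v → x v ^ lookup e v)
    evalMon≡∏ e = ≡.trans (cong (List.foldr _*_ 1#) (List.map-tabulate id powers)) (foldr-tabulate powers)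
      where
      powers : Fin n → Carrier
      powers v = x v ^ lookup e v

    evalMon-+ₘ : ∀ (e f : Monomial n) → evalMon (e +ₘ f) x ≈ evalMon e x * evalMon f x
    evalMon-+ₘ e f = begin
      evalMon (e +ₘ f) x                                         ≡⟨ evalMon≡∏ (e +ₘ f) ⟩
      ∏ (λ v → x v ^ lookup (e +ₘ f) v)                          ≈⟨ ∏-cong exponent-+ ⟩
      ∏ (λ v → x v ^ lookup e v * x v ^ lookup f v)
        ≈⟨ ∏-distrib-* (λ v → x v ^ lookup e v) (λ v → x v ^ lookup f v) ⟩
      ∏ (λ v → x v ^ lookup e v) * ∏ (λ v → x v ^ lookup f v)    ≡⟨ ≡.cong₂ _*_ (evalMon≡∏ e) (evalMon≡∏ f) ⟨
      evalMon e x * evalMon f x                                  ∎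
      where
      open ≈-Reasoning
      exponent-+ : ∀ v → x v ^ lookup (e +ₘ f) v ≈ x v ^ lookup e v * x v ^ lookup f v
      exponent-+ v =
        ≈-trans (reflexive (cong (x v ^_) (Vec.lookup-zipWith ℕ._+_ v e f))) (^-+ (x v) (lookup e v) (lookup f v))

    evalMon-0 : evalMon (replicate n 0) x ≈ 1#
    evalMon-0 = ≈-trans (reflexive (evalMon≡∏ (replicate n 0)))
      (≈-trans (∏-cong (λ v → reflexive (cong (x v ^_) (Vec.lookup-replicate v 0)))) (∏-1# n))

    evalMon-unit : ∀ a → evalMon (unit a) x ≈ x a
    evalMon-unit a = begin
      evalMon (unit a) x                ≡⟨ evalMon≡∏ (unit a) ⟩
      ∏ (λ v → x v ^ lookup (unit a) v) ≈⟨ ∏-δ _ a (λ v v≢a → reflexive (cong (x v ^_) (lookup-unit-≢ v≢a))) ⟩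
      x a ^ lookup (unit a) a           ≡⟨ cong (x a ^_) (Vec.lookup∘updateAt a (replicate n 0)) ⟩
      x a * 1#                          ≈⟨ *-identityʳ (x a) ⟩
      x a                               ∎
      where open ≈-Reasoning

    eval-term-*ₚ : ∀ a (e : Monomial n) q → eval ([ (a , e) ] *ₚ q) x ≈ (a * evalMon e x) * eval q x
    eval-term-*ₚ a e []            = ≈-sym (zeroʳ _)
    eval-term-*ₚ a e ((b , f) ∷ q) = begin
      (a * b) * evalMon (e +ₘ f) x + eval ([ (a , e) ] *ₚ q) x
        ≈⟨ +-cong (*-congˡ (evalMon-+ₘ e f)) (eval-term-*ₚ a e q) ⟩
      (a * b) * (evalMon e x * evalMon f x) + (a * evalMon e x) * eval q x
        ≈⟨ +-congʳ (*-interchange a b _ _) ⟩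
      (a * evalMon e x) * (b * evalMon f x) + (a * evalMon e x) * eval q x
        ≈⟨ ≈-sym (distribˡ _ _ _) ⟩
      (a * evalMon e x) * (b * evalMon f x + eval q x) ∎
      where open ≈-Reasoning

    eval-*ₚ : ∀ (p q : Pol n) → eval (p *ₚ q) x ≈ eval p x * eval q x
    eval-*ₚ []            q = ≈-sym (zeroˡ _)
    eval-*ₚ ((a , e) ∷ p) q = begin
      eval (((a , e) ∷ p) *ₚ q) x                               ≡⟨ cong (λ r → eval r x) (*ₚ-∷ (a , e) p q) ⟩
      eval ([ (a , e) ] *ₚ q ++ p *ₚ q) x                     ≈⟨ eval-++ x ([ (a , e) ] *ₚ q) (p *ₚ q) ⟩
      eval ([ (a , e) ] *ₚ q) x + eval (p *ₚ q) x               ≈⟨ +-cong (eval-term-*ₚ a e q) (eval-*ₚ p q) ⟩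
      (a * evalMon e x) * eval q x + eval p x * eval q x        ≈⟨ ≈-sym (distribʳ _ _ _) ⟩
      (a * evalMon e x + eval p x) * eval q x                   ∎
      where open ≈-Reasoning

    eval-1ₚ : eval 1ₚ x ≈ 1#
    eval-1ₚ = ≈-trans (+-identityʳ _) (≈-trans (*-identityˡ _) evalMon-0)

    eval-var : ∀ a → eval (var a) x ≈ x a
    eval-var a = ≈-trans (+-identityʳ _) (≈-trans (*-identityˡ _) (evalMon-unit a))

    eval-var-var : ∀ a b → eval (var a -ₚ var b) x ≈ x a - x b
    eval-var-var a b =
      ≈-trans (eval-++ x (var a) (-ₚ var b)) (+-cong (eval-var a) (≈-trans (eval--ₚ x (var b)) (-‿cong (eval-var b))))

  ++-cong : ∀ {n} {p p′ q q′ : Pol n} → p ≋ p′ → q ≋ q′ → p ++ q ≋ p′ ++ q′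
  ++-cong {p = p} {p′} {q} {q′} (mk≋ p≈p′) (mk≋ q≈q′) = mk≋ λ e →
    ≈-trans (coeff-++ p q e) (≈-trans (+-cong (p≈p′ e) (q≈q′ e)) (≈-sym (coeff-++ p′ q′ e)))

  ++-interchange : ∀ {n} (p q r s : Pol n) → (p ++ q) ++ (r ++ s) ≋ (p ++ r) ++ (q ++ s)
  ++-interchange p q r s = mk≋ λ e → begin
    coeff ((p ++ q) ++ (r ++ s)) e                     ≈⟨ coeff-++-++ p q r s e ⟩
    (coeff p e + coeff q e) + (coeff r e + coeff s e)  ≈⟨ +-interchange _ _ _ _ ⟩
    (coeff p e + coeff r e) + (coeff q e + coeff s e)  ≈⟨ coeff-++-++ p r q s e ⟨
    coeff ((p ++ r) ++ (q ++ s)) e                     ∎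
    where
    open ≈-Reasoning
    coeff-++-++ : ∀ p q r s e → coeff ((p ++ q) ++ (r ++ s)) e ≈ (coeff p e + coeff q e) + (coeff r e + coeff s e)
    coeff-++-++ p q r s e = ≈-trans (coeff-++ (p ++ q) (r ++ s) e) (+-cong (coeff-++ p q e) (coeff-++ r s e))

  term-cong : ∀ {n} {a b} {f g : Monomial n} → a ≈ b → f ≡ g → [ (a , f) ] ≋ [ (b , g) ]
  term-cong {a = a} {b} {f} a≈b refl = mk≋ coeffs
    where
    coeffs : ∀ e → coeff [ (a , f) ] e ≈ coeff [ (b , f) ] e
    coeffs e with f ≟ₘ e
    ... | yes _ = +-congʳ a≈b
    ... | no _  = ≈-refl

  term-+ : ∀ {n} a b (f : Monomial n) → [ (a + b , f) ] ≋ (a , f) ∷ [ (b , f) ]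
  term-+ a b f = mk≋ coeffs
    where
    coeffs : ∀ e → coeff [ (a + b , f) ] e ≈ coeff ((a , f) ∷ [ (b , f) ]) e
    coeffs e with f ≟ₘ e
    ... | yes f≡e = ≈-trans (+-assoc a b 0#) (+-congˡ (≈-sym (coeff-∷-≡ b [] f≡e)))
    ... | no f≢e  = ≈-sym (coeff-∷-≢ b [] f≢e)

  *ₚ-[] : ∀ {n} (p : Pol n) → p *ₚ [] ≡ []
  *ₚ-[] []      = refl
  *ₚ-[] (_ ∷ p) = *ₚ-[] p

  *ₚ-++ˡ : ∀ {n} (p q r : Pol n) → (p ++ q) *ₚ r ≡ p *ₚ r ++ q *ₚ r
  *ₚ-++ˡ p q r = List.concatMap-++ _ p q

  term-*ₚ-++ : ∀ {n} (t : Term n) (q r : Pol n) → [ t ] *ₚ (q ++ r) ≡ [ t ] *ₚ q ++ [ t ] *ₚ r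
  term-*ₚ-++ (a , e) []      r = refl
  term-*ₚ-++ (a , e) (_ ∷ q) r = cong (_ ∷_) (term-*ₚ-++ (a , e) q r)

  *ₚ-++ʳ : ∀ {n} (p q r : Pol n) → p *ₚ (q ++ r) ≋ p *ₚ q ++ p *ₚ r
  *ₚ-++ʳ []      q r = ≋-refl
  *ₚ-++ʳ (t ∷ p) q r = begin
    (t ∷ p) *ₚ (q ++ r)                            ≡⟨ *ₚ-∷ t p (q ++ r) ⟩
    [ t ] *ₚ (q ++ r) ++ p *ₚ (q ++ r)              ≈⟨ ++-cong (≡⇒≋ (term-*ₚ-++ t q r)) (*ₚ-++ʳ p q r) ⟩
    ([ t ] *ₚ q ++ [ t ] *ₚ r) ++ (p *ₚ q ++ p *ₚ r)
                                                   ≈⟨ ++-interchange ([ t ] *ₚ q) ([ t ] *ₚ r) (p *ₚ q) (p *ₚ r) ⟩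
    ([ t ] *ₚ q ++ p *ₚ q) ++ ([ t ] *ₚ r ++ p *ₚ r) ≡⟨ ≡.sym (≡.cong₂ _++_ (*ₚ-∷ t p q) (*ₚ-∷ t p r)) ⟩
    (t ∷ p) *ₚ q ++ (t ∷ p) *ₚ r                    ∎
    where open ≋-Reasoning

  *ₚ-1ₚ : ∀ {n} (p : Pol n) → p *ₚ 1ₚ ≋ p
  *ₚ-1ₚ []            = ≋-refl
  *ₚ-1ₚ ((a , e) ∷ p) =
    ++-cong (term-cong (*-identityʳ a) (Vec.zipWith-identityʳ ℕ.+-identityʳ e)) (*ₚ-1ₚ p)

  -- Partial derivatives

  natCast-+ : ∀ m k → natCast R (m ℕ.+ k) ≈ natCast R m + natCast R k
  natCast-+ zero    k = ≈-sym (+-identityˡ _)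
  natCast-+ (suc m) k = ≈-trans (+-congˡ (natCast-+ m k)) (≈-sym (+-assoc _ _ _))

  updateAt-+ₘ : ∀ {n m k} (i : Fin n) (e f : Monomial n) →
                updateAt (e +ₘ f) i (λ _ → m ℕ.+ k) ≡ updateAt e i (λ _ → m) +ₘ updateAt f i (λ _ → k)
  updateAt-+ₘ Fin.zero    (_ Vec.∷ e) (_ Vec.∷ f) = refl
  updateAt-+ₘ (Fin.suc i) (_ Vec.∷ e) (_ Vec.∷ f) = cong (_ Vec.∷_) (updateAt-+ₘ i e f)

  module _ {n} (i : Fin n) where

    raise-lower : ∀ {m} (f : Monomial n) → lookup f i ≡ suc m → updateAt (updateAt f i (λ _ → m)) i suc ≡ f
    raise-lower f fᵢ≡1+m = ≡.trans (Vec.updateAt-updateAt i f) (Vec.updateAt-id-local i f (≡.sym fᵢ≡1+m))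

    lower-raise : ∀ {m} (e : Monomial n) → m ≡ lookup e i → updateAt (updateAt e i suc) i (λ _ → m) ≡ e
    lower-raise e m≡eᵢ = ≡.trans (Vec.updateAt-updateAt i e) (Vec.updateAt-id-local i e m≡eᵢ)

    lookup-raise : ∀ (e : Monomial n) → lookup (updateAt e i suc) i ≡ suc (lookup e i)
    lookup-raise e = Vec.lookup∘updateAt i e

    ∂-++ : ∀ (p q : Pol n) → ∂ i (p ++ q) ≡ ∂ i p ++ ∂ i q
    ∂-++ []            q = refl
    ∂-++ ((a , e) ∷ p) q with lookup e i
    ... | zero  = ∂-++ p q
    ... | suc m = cong (_ ∷_) (∂-++ p q)

    ∂^-++ : ∀ j (p q : Pol n) → ∂^ j i (p ++ q) ≡ ∂^ j i p ++ ∂^ j i q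
    ∂^-++ zero    p q = refl
    ∂^-++ (suc j) p q = ≡.trans (cong (∂ i) (∂^-++ j p q)) (∂-++ (∂^ j i p) (∂^ j i q))

    ∂^-∂ : ∀ j (p : Pol n) → ∂^ j i (∂ i p) ≡ ∂^ (suc j) i p
    ∂^-∂ zero    p = refl
    ∂^-∂ (suc j) p = cong (∂ i) (∂^-∂ j p)

    ∂^-[] : ∀ j → ∂^ j i [] ≡ []
    ∂^-[] zero    = refl
    ∂^-[] (suc j) = cong (∂ i) (∂^-[] j)

    ∂-∷-zero : ∀ a {e} (p : Pol n) → lookup e i ≡ 0 → ∂ i ((a , e) ∷ p) ≡ ∂ i p
    ∂-∷-zero a {e} p eᵢ≡0 with lookup e i | eᵢ≡0
    ... | _ | refl = refl

    ∂-∷-suc : ∀ a {e m} (p : Pol n) → lookup e i ≡ suc m →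
              ∂ i ((a , e) ∷ p) ≡ (natCast R (suc m) * a , updateAt e i (λ _ → m)) ∷ ∂ i p
    ∂-∷-suc a {e} p eᵢ≡1+m with lookup e i | eᵢ≡1+m
    ... | _ | refl = refl

    coeff-∂ : ∀ (p : Pol n) e → coeff (∂ i p) e ≈ natCast R (suc (lookup e i)) * coeff p (updateAt e i suc)
    coeff-∂ []            e = ≈-sym (zeroʳ _)
    coeff-∂ ((a , f) ∷ p) e with lookup f i in fᵢ≡
    ... | zero = ≈-trans (coeff-∂ p e) (*-congˡ (≈-sym (coeff-∷-≢ a p f≢)))
      where
      f≢ : f ≢ updateAt e i suc
      f≢ f≡ = ℕ.0≢1+n (≡.trans (≡.sym fᵢ≡) (≡.trans (cong (λ g → lookup g i) f≡) (lookup-raise e)))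
    ... | suc m with updateAt f i (λ _ → m) ≟ₘ e
    ...   | no f↓≢e = ≈-trans (coeff-∂ p e) (*-congˡ (≈-sym (coeff-∷-≢ a p f≢)))
      where
      f≢ : f ≢ updateAt e i suc
      f≢ f≡ = f↓≢e (≡.trans (cong (λ g → updateAt g i (λ _ → m)) f≡) (lower-raise e (ℕ.suc-injective 1+m≡)))
        where
        1+m≡ : suc m ≡ suc (lookup e i)
        1+m≡ = ≡.trans (≡.sym fᵢ≡) (≡.trans (cong (λ g → lookup g i) f≡) (lookup-raise e))
    ...   | yes f↓≡e with ≡.trans (≡.sym (Vec.lookup∘updateAt i f)) (cong (λ g → lookup g i) f↓≡e)
    ...     | refl = ≈-trans (+-congˡ (coeff-∂ p e))
                       (≈-trans (≈-sym (distribˡ _ _ _)) (*-congˡ (≈-sym (coeff-∷-≡ a p f≡))))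
      where
      f≡ : f ≡ updateAt e i suc
      f≡ = ≡.trans (≡.sym (raise-lower f fᵢ≡)) (cong (λ g → updateAt g i suc) f↓≡e)

    ∂-cong : ∀ {p q : Pol n} → p ≋ q → ∂ i p ≋ ∂ i q
    ∂-cong {p} {q} (mk≋ p≈q) = mk≋ λ e →
      ≈-trans (coeff-∂ p e) (≈-trans (*-congˡ (p≈q _)) (≈-sym (coeff-∂ q e)))

    ∂^-cong : ∀ j {p q : Pol n} → p ≋ q → ∂^ j i p ≋ ∂^ j i q
    ∂^-cong zero    p≋q = p≋q
    ∂^-cong (suc j) p≋q = ∂-cong (∂^-cong j p≋q)

    lookup-+ₘ : ∀ (e f : Monomial n) {m k} → lookup e i ≡ m → lookup f i ≡ k → lookup (e +ₘ f) i ≡ m ℕ.+ k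
    lookup-+ₘ e f eᵢ≡m fᵢ≡k = ≡.trans (Vec.lookup-zipWith ℕ._+_ i e f) (≡.cong₂ ℕ._+_ eᵢ≡m fᵢ≡k)

    updateAt-+ₘˡ : ∀ {m k} (e f : Monomial n) → lookup f i ≡ k →
                   updateAt (e +ₘ f) i (λ _ → m ℕ.+ k) ≡ updateAt e i (λ _ → m) +ₘ f
    updateAt-+ₘˡ e f fᵢ≡k =
      ≡.trans (updateAt-+ₘ i e f) (cong (updateAt e i _ +ₘ_) (Vec.updateAt-id-local i f (≡.sym fᵢ≡k)))

    updateAt-+ₘʳ : ∀ {m k} (e f : Monomial n) → lookup e i ≡ m →
                   updateAt (e +ₘ f) i (λ _ → m ℕ.+ k) ≡ e +ₘ updateAt f i (λ _ → k)
    updateAt-+ₘʳ e f eᵢ≡m =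
      ≡.trans (updateAt-+ₘ i e f) (cong (_+ₘ updateAt f i _) (Vec.updateAt-id-local i e (≡.sym eᵢ≡m)))

    ∂-term-*ₚ-term : ∀ a (e : Monomial n) b f →
      ∂ i [ (a * b , e +ₘ f) ] ≋ ∂ i [ (a , e) ] *ₚ [ (b , f) ] ++ [ (a , e) ] *ₚ ∂ i [ (b , f) ]
    ∂-term-*ₚ-term a e b f with lookup e i in eᵢ≡ | lookup f i in fᵢ≡
    ... | zero  | zero  = ≡⇒≋ (∂-∷-zero (a * b) {e +ₘ f} [] (lookup-+ₘ e f eᵢ≡ fᵢ≡))
    ... | suc m | zero  = begin
      ∂ i [ (a * b , e +ₘ f) ]
        ≡⟨ ∂-∷-suc (a * b) {e +ₘ f} [] (lookup-+ₘ e f eᵢ≡ fᵢ≡) ⟩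
      [ (natCast R (suc (m ℕ.+ 0)) * (a * b) , updateAt (e +ₘ f) i (λ _ → m ℕ.+ 0)) ]
        ≈⟨ term-cong coefficient (updateAt-+ₘˡ e f fᵢ≡) ⟩
      [ ((natCast R (suc m) * a) * b , updateAt e i (λ _ → m) +ₘ f) ] ∎
      where
      open ≋-Reasoning
      coefficient : natCast R (suc (m ℕ.+ 0)) * (a * b) ≈ (natCast R (suc m) * a) * b
      coefficient =
        ≈-trans (reflexive (cong (λ k → natCast R (suc k) * (a * b)) (ℕ.+-identityʳ m))) (≈-sym (*-assoc _ _ _))
    ... | zero  | suc k = begin
      ∂ i [ (a * b , e +ₘ f) ]
        ≡⟨ ∂-∷-suc (a * b) {e +ₘ f} [] (lookup-+ₘ e f eᵢ≡ fᵢ≡) ⟩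
      [ (natCast R (suc k) * (a * b) , updateAt (e +ₘ f) i (λ _ → 0 ℕ.+ k)) ]
        ≈⟨ term-cong (*-x∙yz≈y∙xz _ _ _) (updateAt-+ₘʳ e f eᵢ≡) ⟩
      [ (a * (natCast R (suc k) * b) , e +ₘ updateAt f i (λ _ → k)) ] ∎
      where open ≋-Reasoning
    ... | suc m | suc k = begin
      ∂ i [ (a * b , e +ₘ f) ]
        ≡⟨ ∂-∷-suc (a * b) {e +ₘ f} [] (lookup-+ₘ e f eᵢ≡ fᵢ≡) ⟩
      [ (natCast R (suc (m ℕ.+ suc k)) * (a * b) , lowered) ]
        ≈⟨ term-cong coefficient refl ⟩
      [ (a′ + b′ , lowered) ]
        ≈⟨ term-+ a′ b′ lowered ⟩
      (a′ , lowered) ∷ [ (b′ , lowered) ]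
        ≡⟨ ≡.cong₂ (λ g h → (a′ , g) ∷ [ (b′ , h) ]) (updateAt-+ₘˡ e f fᵢ≡) lowered≡ ⟩
      (a′ , updateAt e i (λ _ → m) +ₘ f) ∷ [ (b′ , e +ₘ updateAt f i (λ _ → k)) ] ∎
      where
      open ≋-Reasoning
      a′ b′ : Carrier
      a′ = (natCast R (suc m) * a) * b
      b′ = a * (natCast R (suc k) * b)
      lowered : Monomial n
      lowered = updateAt (e +ₘ f) i (λ _ → m ℕ.+ suc k)
      coefficient : natCast R (suc (m ℕ.+ suc k)) * (a * b) ≈ a′ + b′
      coefficient = ≈-trans (*-congʳ (natCast-+ (suc m) (suc k)))
        (≈-trans (distribʳ _ _ _) (+-cong (≈-sym (*-assoc _ _ _)) (*-x∙yz≈y∙xz _ _ _)))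
      lowered≡ : lowered ≡ e +ₘ updateAt f i (λ _ → k)
      lowered≡ = ≡.trans (cong (λ r → updateAt (e +ₘ f) i (λ _ → r)) (ℕ.+-suc m k)) (updateAt-+ₘʳ e f eᵢ≡)

    ∂-term-*ₚ : ∀ (t : Term n) (q : Pol n) → ∂ i ([ t ] *ₚ q) ≋ ∂ i [ t ] *ₚ q ++ [ t ] *ₚ ∂ i q
    ∂-term-*ₚ (a , e) []            = ≡⇒≋ (≡.sym (cong (_++ []) (*ₚ-[] (∂ i [ (a , e) ]))))
    ∂-term-*ₚ (a , e) ((b , f) ∷ q) = begin
      ∂ i ([ t ] *ₚ (s ∷ q))
        ≡⟨ ∂-++ [ (a * b , e +ₘ f) ] ([ t ] *ₚ q) ⟩
      ∂ i [ (a * b , e +ₘ f) ] ++ ∂ i ([ t ] *ₚ q)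
        ≈⟨ ++-cong (∂-term-*ₚ-term a e b f) (∂-term-*ₚ t q) ⟩
      (∂ i [ t ] *ₚ [ s ] ++ [ t ] *ₚ ∂ i [ s ]) ++ (∂ i [ t ] *ₚ q ++ [ t ] *ₚ ∂ i q)
        ≈⟨ ++-interchange (∂ i [ t ] *ₚ [ s ]) ([ t ] *ₚ ∂ i [ s ]) (∂ i [ t ] *ₚ q) ([ t ] *ₚ ∂ i q) ⟩
      (∂ i [ t ] *ₚ [ s ] ++ ∂ i [ t ] *ₚ q) ++ ([ t ] *ₚ ∂ i [ s ] ++ [ t ] *ₚ ∂ i q)
        ≈⟨ ++-cong (*ₚ-++ʳ (∂ i [ t ]) [ s ] q) (≡⇒≋ (term-*ₚ-++ t (∂ i [ s ]) (∂ i q))) ⟨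
      ∂ i [ t ] *ₚ (s ∷ q) ++ [ t ] *ₚ (∂ i [ s ] ++ ∂ i q)
        ≡⟨ cong (λ r → ∂ i [ t ] *ₚ (s ∷ q) ++ [ t ] *ₚ r) (≡.sym (∂-++ [ s ] q)) ⟩
      ∂ i [ t ] *ₚ (s ∷ q) ++ [ t ] *ₚ ∂ i (s ∷ q) ∎
      where
      open ≋-Reasoning
      t s : Term n
      t = (a , e)
      s = (b , f)

    ∂-*ₚ : ∀ (p q : Pol n) → ∂ i (p *ₚ q) ≋ ∂ i p *ₚ q ++ p *ₚ ∂ i q
    ∂-*ₚ []      q = ≋-refl
    ∂-*ₚ (t ∷ p) q = begin
      ∂ i ((t ∷ p) *ₚ q)
        ≡⟨ ≡.trans (cong (∂ i) (*ₚ-∷ t p q)) (∂-++ ([ t ] *ₚ q) (p *ₚ q)) ⟩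
      ∂ i ([ t ] *ₚ q) ++ ∂ i (p *ₚ q)
        ≈⟨ ++-cong (∂-term-*ₚ t q) (∂-*ₚ p q) ⟩
      (∂ i [ t ] *ₚ q ++ [ t ] *ₚ ∂ i q) ++ (∂ i p *ₚ q ++ p *ₚ ∂ i q)
        ≈⟨ ++-interchange (∂ i [ t ] *ₚ q) ([ t ] *ₚ ∂ i q) (∂ i p *ₚ q) (p *ₚ ∂ i q) ⟩
      (∂ i [ t ] *ₚ q ++ ∂ i p *ₚ q) ++ ([ t ] *ₚ ∂ i q ++ p *ₚ ∂ i q)
        ≡⟨ ≡.cong₂ _++_ (≡.sym (*ₚ-++ˡ (∂ i [ t ]) (∂ i p) q)) (≡.sym (*ₚ-∷ t p (∂ i q))) ⟩
      (∂ i [ t ] ++ ∂ i p) *ₚ q ++ (t ∷ p) *ₚ ∂ i q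
        ≡⟨ cong (λ r → r *ₚ q ++ (t ∷ p) *ₚ ∂ i q) (≡.sym (∂-++ [ t ] p)) ⟩
      ∂ i (t ∷ p) *ₚ q ++ (t ∷ p) *ₚ ∂ i q ∎
      where open ≋-Reasoning

  -- Order of vanishing along a coordinate direction

  suc<+⇒<pred+ : ∀ {j} r {s} → suc j < r ℕ.+ s → j < ℕ.pred r ℕ.+ s
  suc<+⇒<pred+ zero    1+j<s         = ℕ.<-trans (ℕ.n<1+n _) 1+j<s
  suc<+⇒<pred+ (suc r) (s≤s 1+j≤r+s) = 1+j≤r+s

  suc<+⇒<+pred : ∀ {j} r s → suc j < r ℕ.+ s → j < r ℕ.+ ℕ.pred s
  suc<+⇒<+pred {j} r s 1+j<r+s =
    ≡.subst (j <_) (ℕ.+-comm (ℕ.pred s) r) (suc<+⇒<pred+ s (≡.subst (suc j <_) (ℕ.+-comm r s) 1+j<r+s))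

  _^ₚ_ : ∀ {n} → Pol n → ℕ → Pol n
  p ^ₚ zero  = 1ₚ
  p ^ₚ suc k = p *ₚ (p ^ₚ k)

  module _ {n} (i : Fin n) (x : Fin n → Carrier) where

    Vanishes : ℕ → Pol n → Set ℓ
    Vanishes r p = ∀ j → j < r → eval (∂^ j i p) x ≈ 0#

    vanishes-0 : ∀ (p : Pol n) → Vanishes 0 p
    vanishes-0 p j ()

    vanishes-cong : ∀ {r} {p q : Pol n} → p ≋ q → Vanishes r p → Vanishes r q
    vanishes-cong p≋q vp j j<r = ≈-trans (eval-cong x (∂^-cong i j (≋-sym p≋q))) (vp j j<r)

    vanishes-++ : ∀ {r} (p q : Pol n) → Vanishes r p → Vanishes r q → Vanishes r (p ++ q)
    vanishes-++ p q vp vq j j<r = begin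
      eval (∂^ j i (p ++ q)) x                 ≡⟨ cong (λ s → eval s x) (∂^-++ i j p q) ⟩
      eval (∂^ j i p ++ ∂^ j i q) x            ≈⟨ eval-++ x (∂^ j i p) (∂^ j i q) ⟩
      eval (∂^ j i p) x + eval (∂^ j i q) x    ≈⟨ +-cong (vp j j<r) (vq j j<r) ⟩
      0# + 0#                                  ≈⟨ +-identityʳ 0# ⟩
      0#                                       ∎
      where open ≈-Reasoning

    vanishes-sumₚ : ∀ {r} {ps : List (Pol n)} → All (Vanishes r) ps → Vanishes r (sumₚ ps)
    vanishes-sumₚ All.[]         j j<r = reflexive (cong (λ s → eval s x) (∂^-[] i j))
    vanishes-sumₚ (vp All.∷ vps)       = vanishes-++ _ _ vp (vanishes-sumₚ vps)

    vanishes-∂ : ∀ {r} (p : Pol n) → Vanishes r p → Vanishes (ℕ.pred r) (∂ i p)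
    vanishes-∂ {suc r} p vp j j<r = ≈-trans (reflexive (cong (λ s → eval s x) (∂^-∂ i j p))) (vp (suc j) (s≤s j<r))

    vanishes-*ₚ : ∀ {r s} (p q : Pol n) → Vanishes r p → Vanishes s q → Vanishes (r ℕ.+ s) (p *ₚ q)
    vanishes-*ₚ {zero}  p q vp vq zero 0<s = ≈-trans (eval-*ₚ x p q) (≈-trans (*-congˡ (vq 0 0<s)) (zeroʳ _))
    vanishes-*ₚ {suc r} p q vp vq zero _   = ≈-trans (eval-*ₚ x p q) (≈-trans (*-congʳ (vp 0 (s≤s z≤n))) (zeroˡ _))
    vanishes-*ₚ {r} {s} p q vp vq (suc j) 1+j<r+s = begin
      eval (∂^ (suc j) i (p *ₚ q)) x
        ≡⟨ cong (λ t → eval t x) (≡.sym (∂^-∂ i j (p *ₚ q))) ⟩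
      eval (∂^ j i (∂ i (p *ₚ q))) x
        ≈⟨ eval-cong x (∂^-cong i j (∂-*ₚ i p q)) ⟩
      eval (∂^ j i (∂ i p *ₚ q ++ p *ₚ ∂ i q)) x
        ≡⟨ cong (λ t → eval t x) (∂^-++ i j (∂ i p *ₚ q) (p *ₚ ∂ i q)) ⟩
      eval (∂^ j i (∂ i p *ₚ q) ++ ∂^ j i (p *ₚ ∂ i q)) x
        ≈⟨ eval-++ x (∂^ j i (∂ i p *ₚ q)) (∂^ j i (p *ₚ ∂ i q)) ⟩
      eval (∂^ j i (∂ i p *ₚ q)) x + eval (∂^ j i (p *ₚ ∂ i q)) x
        ≈⟨ +-cong (vanishes-*ₚ (∂ i p) q (vanishes-∂ p vp) vq j (suc<+⇒<pred+ r 1+j<r+s))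
                  (vanishes-*ₚ p (∂ i q) vp (vanishes-∂ q vq) j (suc<+⇒<+pred r s 1+j<r+s)) ⟩
      0# + 0#
        ≈⟨ +-identityʳ 0# ⟩
      0# ∎
      where open ≈-Reasoning

    vanishes-*ₚˡ : ∀ {r} (p q : Pol n) → Vanishes r p → Vanishes r (p *ₚ q)
    vanishes-*ₚˡ {r} p q vp =
      ≡.subst (λ s → Vanishes s (p *ₚ q)) (ℕ.+-identityʳ r) (vanishes-*ₚ p q vp (vanishes-0 q))

    vanishes-*ₚʳ : ∀ {r} (p q : Pol n) → Vanishes r q → Vanishes r (p *ₚ q)
    vanishes-*ₚʳ p q vq = vanishes-*ₚ p q (vanishes-0 p) vq

    vanishes-prodₚ : ∀ {r} {ps : List (Pol n)} → Any (Vanishes r) ps → Vanishes r (prodₚ ps)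
    vanishes-prodₚ {ps = p ∷ ps} (here vp)  = vanishes-*ₚˡ p (prodₚ ps) vp
    vanishes-prodₚ {ps = p ∷ ps} (there vq) = vanishes-*ₚʳ p (prodₚ ps) (vanishes-prodₚ vq)

    vanishes-^ₚ : ∀ (p : Pol n) k → Vanishes 1 p → Vanishes k (p ^ₚ k)
    vanishes-^ₚ p zero    _  = vanishes-0 (p ^ₚ zero)
    vanishes-^ₚ p (suc k) vp = vanishes-*ₚ p (p ^ₚ k) vp (vanishes-^ₚ p k vp)

    vanishes-var-var : ∀ {a b} → x a ≈ x b → Vanishes 1 (var a -ₚ var b)
    vanishes-var-var {a} {b} xa≈xb zero    _           = ≈-trans (eval-var-var x a b) (x≈y⇒x∙y⁻¹≈ε xa≈xb)
    vanishes-var-var             xa≈xb (suc j) (s≤s ())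

    ∂-var-var : ∀ {a b} → a ≢ i → b ≢ i → ∂ i (var a -ₚ var b) ≡ []
    ∂-var-var {a} {b} a≢i b≢i = ≡.trans (∂-∷-zero i 1# {unit a} (-ₚ var b) (lookup-unit-≢ (a≢i ∘ ≡.sym)))
                                        (∂-∷-zero i (- 1#) {unit b} [] (lookup-unit-≢ (b≢i ∘ ≡.sym)))

    vanishes-var-var-transverse : ∀ {r a b} → a ≢ i → b ≢ i → x a ≈ x b → Vanishes r (var a -ₚ var b)
    vanishes-var-var-transverse a≢i b≢i xa≈xb zero    _ = vanishes-var-var xa≈xb zero (s≤s z≤n)
    vanishes-var-var-transverse {a = a} {b} a≢i b≢i xa≈xb (suc j) _ = reflexive (cong (λ s → eval s x) ∂ʲ⁺¹≡[])
      where
      ∂ʲ⁺¹≡[] : ∂^ (suc j) i (var a -ₚ var b) ≡ []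
      ∂ʲ⁺¹≡[] = ≡.trans (≡.sym (∂^-∂ i j (var a -ₚ var b)))
                        (≡.trans (cong (∂^ j i) (∂-var-var a≢i b≢i)) (∂^-[] i j))

    vanishes-factor : ∀ {r a b c} → a ≢ b → a ≢ c → b ≢ c → x a ≈ x b → x b ≈ x c →
                      Vanishes r (factor (a , b , c))
    vanishes-factor {r} {a} {b} {c} a≢b a≢c b≢c xa≈xb xb≈xc with a Fin.≟ i | b Fin.≟ i
    ... | no a≢i   | no b≢i   = vanishes-*ₚˡ _ (var b -ₚ var c) (vanishes-*ₚˡ (var a -ₚ var b) (var a -ₚ var c)
                                  (vanishes-var-var-transverse a≢i b≢i xa≈xb))
    ... | yes refl | _        = vanishes-*ₚʳ ((var a -ₚ var b) *ₚ (var a -ₚ var c)) _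
                                  (vanishes-var-var-transverse (a≢b ∘ ≡.sym) (a≢c ∘ ≡.sym) xb≈xc)
    ... | no a≢i   | yes refl = vanishes-*ₚˡ _ (var b -ₚ var c) (vanishes-*ₚʳ (var a -ₚ var b) (var a -ₚ var c)
                                  (vanishes-var-var-transverse a≢i (b≢c ∘ ≡.sym) (≈-trans xa≈xb xb≈xc)))

  data Perm₃ {A : Set} (a b c : A) : A → A → A → Set where
    abc : Perm₃ a b c a b c
    acb : Perm₃ a b c a c b
    bac : Perm₃ a b c b a c
    bca : Perm₃ a b c b c a
    cab : Perm₃ a b c c a b
    cba : Perm₃ a b c c b a

  Symmetric₃ : ∀ {A : Set} {t} → (A → A → A → Set t) → Set t
  Symmetric₃ T = ∀ {a b c} → (T a b c → T b a c) × (T a b c → T a c b)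

  perm₃-transport : ∀ {A : Set} {t} {T : A → A → A → Set t} → Symmetric₃ T →
                    ∀ {a b c a′ b′ c′} → Perm₃ a b c a′ b′ c′ → T a b c → T a′ b′ c′
  perm₃-transport T-sym abc = id
  perm₃-transport T-sym acb = proj₂ T-sym
  perm₃-transport T-sym bac = proj₁ T-sym
  perm₃-transport T-sym bca = proj₂ T-sym ∘ proj₁ T-sym
  perm₃-transport T-sym cab = proj₁ T-sym ∘ proj₂ T-sym
  perm₃-transport T-sym cba = proj₁ T-sym ∘ proj₂ T-sym ∘ proj₁ T-sym

  SomePair : ∀ {A : Set} {t} → (A → A → Set t) → A → A → A → Set t
  SomePair S a b c = S a b ⊎ S a c ⊎ S b c

  somePair-symmetric₃ : ∀ {A : Set} {t} {S : A → A → Set t} → (∀ {a b} → S a b → S b a) →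
                        Symmetric₃ (SomePair S)
  somePair-symmetric₃ {S = S} S-sym = swap₁₂ , swap₂₃
    where
    swap₁₂ : ∀ {a b c} → SomePair S a b c → SomePair S b a c
    swap₁₂ (inj₁ ab)        = inj₁ (S-sym ab)
    swap₁₂ (inj₂ (inj₁ ac)) = inj₂ (inj₂ ac)
    swap₁₂ (inj₂ (inj₂ bc)) = inj₂ (inj₁ bc)
    swap₂₃ : ∀ {a b c} → SomePair S a b c → SomePair S a c b
    swap₂₃ (inj₁ ab)        = inj₂ (inj₁ ab)
    swap₂₃ (inj₂ (inj₁ ac)) = inj₁ ac
    swap₂₃ (inj₂ (inj₂ bc)) = inj₂ (inj₂ (S-sym bc))

  record Sorting₃ {n} (a b c : Fin n) : Set where
    constructor sorted
    field
      {a′ b′ c′} : Fin n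
      a′<b′      : a′ Fin.< b′
      b′<c′      : b′ Fin.< c′
      perm       : Perm₃ a b c a′ b′ c′

  sort₃ : ∀ {n} {a b c : Fin n} → a ≢ b → a ≢ c → b ≢ c → Sorting₃ a b c
  sort₃ {a = a} {b} {c} a≢b a≢c b≢c with Fin.<-cmp a b | Fin.<-cmp a c | Fin.<-cmp b c
  ... | tri≈ _ a≡b _ | _            | _            = contradiction a≡b a≢b
  ... | _            | tri≈ _ a≡c _ | _            = contradiction a≡c a≢c
  ... | _            | _            | tri≈ _ b≡c _ = contradiction b≡c b≢c
  ... | tri< a<b _ _ | _            | tri< b<c _ _ = sorted a<b b<c abc
  ... | tri< _ _ _   | tri< a<c _ _ | tri> _ _ c<b = sorted a<c c<b acb
  ... | tri> _ _ b<a | tri< a<c _ _ | _            = sorted b<a a<c bac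
  ... | _            | tri> _ _ c<a | tri< b<c _ _ = sorted b<c c<a bca
  ... | tri< a<b _ _ | tri> _ _ c<a | _            = sorted c<a a<b cab
  ... | tri> _ _ b<a | _            | tri> _ _ c<b = sorted c<b b<a cba

  third : ∀ {l} → 3 ≤ l → (u v : Fin l) → ∃ λ w → w ≢ u × w ≢ v
  third (s≤s (s≤s (s≤s _))) Fin.zero          Fin.zero                = Fin.suc Fin.zero , (λ ()) , (λ ())
  third (s≤s (s≤s (s≤s _))) Fin.zero          (Fin.suc Fin.zero)      = Fin.suc (Fin.suc Fin.zero) , (λ ()) , (λ ())
  third (s≤s (s≤s (s≤s _))) Fin.zero          (Fin.suc (Fin.suc _))   = Fin.suc Fin.zero , (λ ()) , (λ ())
  third (s≤s (s≤s (s≤s _))) (Fin.suc Fin.zero)    Fin.zero            = Fin.suc (Fin.suc Fin.zero) , (λ ()) , (λ ())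
  third (s≤s (s≤s (s≤s _))) (Fin.suc (Fin.suc _)) Fin.zero            = Fin.suc Fin.zero , (λ ()) , (λ ())
  third (s≤s (s≤s (s≤s _))) (Fin.suc _)       (Fin.suc _)             = Fin.zero , (λ ()) , (λ ())

  injective-≢ : ∀ {l n} {ι : Fin l → Fin n} → Injective ι → ∀ {u v} → u ≢ v → ι u ≢ ι v
  injective-≢ ι-inj u≢v ιu≡ιv = u≢v (ι-inj _ _ ιu≡ιv)

  Triple : ℕ → Set
  Triple n = Fin n × Fin n × Fin n

  -- `triples` and `pG` select their entries with local helpers of Defs; unification recovers them,
  -- and pG G is then definitionally prodₚ (pGFactors G).
  private
    tripleSelection : ∀ n → Σ (Fin n → Fin n → Fin n → List (Triple n)) λ pick →
      triples n ≡ concatMap (λ a → concatMap (λ b → concatMap (pick a b) (allFin n)) (allFin n)) (allFin n)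
    tripleSelection n = _ , refl

    factorSelection : ∀ {n} (G : ThreeGraph n) → Σ (Triple n → List (Pol n)) λ select →
      pG G ≡ prodₚ (concatMap select (triples n))
    factorSelection G = _ , refl

  ∈-triples : ∀ {n} {a b c : Fin n} → a Fin.< b → b Fin.< c → (a , b , c) ∈ triples n
  ∈-triples {n} {a} {b} {c} a<b b<c =
    ∈-concatMap⁺ _ (lose (∈-allFin a)
      (∈-concatMap⁺ _ (lose (∈-allFin b)
        (∈-concatMap⁺ _ (lose (∈-allFin c) picked)))))
    where
    picked : (a , b , c) ∈ proj₁ (tripleSelection n) a b c
    picked with toℕ a ℕ.<? toℕ b | toℕ b ℕ.<? toℕ c
    ... | yes _   | yes _   = here refl
    ... | no a≮b  | _       = contradiction a<b a≮b
    ... | yes _   | no b≮c  = contradiction b<c b≮c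

  pGFactors : ∀ {n} → ThreeGraph n → List (Pol n)
  pGFactors {n} G = concatMap (proj₁ (factorSelection G)) (triples n)

  factor∈pGFactors : ∀ {n} (G : ThreeGraph n) {a b c} → a Fin.< b → b Fin.< c →
                     ThreeGraph.edge G a b c ≡ false → factor (a , b , c) ∈ pGFactors G
  factor∈pGFactors G {a} {b} {c} a<b b<c nonedge = ∈-concatMap⁺ _ (lose (∈-triples a<b b<c) (selected nonedge))
    where
    selected : ThreeGraph.edge G a b c ≡ false → factor (a , b , c) ∈ proj₁ (factorSelection G) (a , b , c)
    selected edge≡false with ThreeGraph.edge G a b c
    ... | false = here refl

  partite-nonedge : ∀ {n m} (G : ThreeGraph n) ((col , _) : IsPartite m G) {a b c} → a Fin.< b → b Fin.< c →
                    SomePair (λ s t → col s ≡ col t) a b c → ThreeGraph.edge G a b c ≡ false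
  partite-nonedge G (col , proper) {a} {b} {c} a<b b<c same with ThreeGraph.edge G a b c in edge≡
  ... | false = refl
  ... | true with proper a b c a<b b<c edge≡ | same
  ...   | ab≢ , _ , _ | inj₁ ab        = contradiction ab ab≢
  ...   | _ , ac≢ , _ | inj₂ (inj₁ ac) = contradiction ac ac≢
  ...   | _ , _ , bc≢ | inj₂ (inj₂ bc) = contradiction bc bc≢

  -- By pigeonhole two of the ι u share a colour, so with any third one they span a non-edge of G, whose
  -- factor occurs in p_G; sorting that triple preserves every symmetric property T of (ι u, ι v, ι w).
  missing-factor : ∀ {n l} {G : ThreeGraph n} → 3 ≤ l → IsPartite (l ∸ 1) G →
    (ι : Fin l → Fin n) → Injective ι →
    {T : Fin n → Fin n → Fin n → Set ℓ} → Symmetric₃ T →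
    (∀ {u v w} → u ≢ v → u ≢ w → v ≢ w → T (ι u) (ι v) (ι w)) →
    {P : Pol n → Set ℓ} → (∀ {a b c} → a Fin.< b → b Fin.< c → T a b c → P (factor (a , b , c))) →
    Any P (pGFactors G)
  missing-factor {n} {suc m} {G} 3≤l (col , proper) ι ι-inj T-sym T-holds P-factor
    with Fin.pigeonhole (ℕ.n<1+n m) (col ∘ ι)
  ... | u , v , u<v , same-colour with third 3≤l u v
  ... | w , w≢u , w≢v
    with sort₃ (injective-≢ ι-inj (Fin.<⇒≢ u<v)) (injective-≢ ι-inj (w≢u ∘ ≡.sym)) (injective-≢ ι-inj (w≢v ∘ ≡.sym))
  ... | sorted {a} {b} {c} a<b b<c perm =
    lose (factor∈pGFactors G a<b b<c (partite-nonedge G (col , proper) a<b b<c (transport colour-sym (inj₁ same-colour))))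
         (P-factor a<b b<c (transport T-sym (T-holds (Fin.<⇒≢ u<v) (w≢u ∘ ≡.sym) (w≢v ∘ ≡.sym))))
    where
    transport : ∀ {t} {T : Fin n → Fin n → Fin n → Set t} → Symmetric₃ T → T (ι u) (ι v) (ι w) → T a b c
    transport T-sym = perm₃-transport T-sym perm
    colour-sym : Symmetric₃ (SomePair (λ s t → col s ≡ col t))
    colour-sym = somePair-symmetric₃ {S = λ s t → col s ≡ col t} ≡.sym

  -- P̂(n,ℓ) ⊆ DI(n,ℓ)

  Equal₃ : ∀ {n} → (Fin n → Carrier) → Fin n → Fin n → Fin n → Set ℓ
  Equal₃ x a b c = x a ≈ x b × x b ≈ x c

  equal₃-symmetric₃ : ∀ {n} {x : Fin n → Carrier} → Symmetric₃ (Equal₃ x)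
  equal₃-symmetric₃ = (λ (ab , bc) → ≈-sym ab , ≈-trans ab bc) , (λ (ab , bc) → ≈-trans ab bc , ≈-sym bc)

  pG-vanishes : ∀ {n l} {G : ThreeGraph n} → 3 ≤ l → IsPartite (l ∸ 1) G →
    (ι : Fin l → Fin n) → Injective ι → (x : Fin n → Carrier) → (∀ u v → x (ι u) ≈ x (ι v)) →
    ∀ i r → Vanishes i x r (pG G)
  pG-vanishes 3≤l partite ι ι-inj x x-diag i r =
    vanishes-prodₚ i x (missing-factor 3≤l partite ι ι-inj (equal₃-symmetric₃ {x = x})
      (λ {u} {v} {w} _ _ _ → x-diag u v , x-diag v w)
      (λ a<b b<c (xa≈xb , xb≈xc) →
         vanishes-factor i x (Fin.<⇒≢ a<b) (Fin.<⇒≢ (Fin.<-trans a<b b<c)) (Fin.<⇒≢ b<c) xa≈xb xb≈xc))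

  combinationTerms : ∀ {n m} → List (Pol n × PartiteGraph n m) → List (Pol n)
  combinationTerms = List.map (λ y → proj₁ y *ₚ pG (proj₁ (proj₂ y)))

  Phat⇒≋ : ∀ {n l} {p : Pol n} (h : Phat n l p) → p ≋ sumₚ (combinationTerms (proj₁ h))
  Phat⇒≋ (_ , p≈sum) = mk≋ p≈sum

  Phat⊆DI : ∀ {n l} → 3 ≤ l → (p : Pol n) → Phat n l p → DI n l p
  Phat⊆DI {n} {l} 3≤l p p∈Phat i j _ ι ι-inj x x-diag =
    vanishes-cong i x (≋-sym (Phat⇒≋ {l = l} {p} p∈Phat))
      (vanishes-sumₚ i x {ps = combinationTerms (proj₁ p∈Phat)}
        (All.map⁺ (All.universal term-vanishes (proj₁ p∈Phat))))
      j (ℕ.n<1+n j)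
    where
    term-vanishes : ∀ (y : Pol n × PartiteGraph n (l ∸ 1)) → Vanishes i x (suc j) (proj₁ y *ₚ pG (proj₁ (proj₂ y)))
    term-vanishes (a , G , partite) = vanishes-*ₚʳ i x a (pG G) (pG-vanishes 3≤l partite ι ι-inj x x-diag i (suc j))

  -- A polynomial of DI(n,ℓ) outside P̂(n,ℓ)

  module _ {n} (y : Fin n → Carrier) where

    eval-sumₚ-zero : ∀ {ps : List (Pol n)} → All (λ p → eval p y ≈ 0#) ps → eval (sumₚ ps) y ≈ 0#
    eval-sumₚ-zero All.[]                    = ≈-refl
    eval-sumₚ-zero {p ∷ ps} (p≈0 All.∷ ps≈0) =
      ≈-trans (eval-++ y p (sumₚ ps)) (≈-trans (+-cong p≈0 (eval-sumₚ-zero ps≈0)) (+-identityʳ 0#))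

    eval-prodₚ-zero : ∀ {ps : List (Pol n)} → Any (λ p → eval p y ≈ 0#) ps → eval (prodₚ ps) y ≈ 0#
    eval-prodₚ-zero {p ∷ ps} (here p≈0)   =
      ≈-trans (eval-*ₚ y p (prodₚ ps)) (≈-trans (*-congʳ p≈0) (zeroˡ _))
    eval-prodₚ-zero {p ∷ ps} (there ps≈0) =
      ≈-trans (eval-*ₚ y p (prodₚ ps)) (≈-trans (*-congˡ (eval-prodₚ-zero ps≈0)) (zeroʳ _))

    eval-factor-zero : ∀ {a b c} → SomePair (λ s t → y s ≈ y t) a b c → eval (factor (a , b , c)) y ≈ 0#
    eval-factor-zero {a} {b} {c} same = ≈-trans (eval-*ₚ y ((var a -ₚ var b) *ₚ (var a -ₚ var c)) (var b -ₚ var c))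
      (≈-trans (*-congʳ (eval-*ₚ y (var a -ₚ var b) (var a -ₚ var c))) (product≈0 same))
      where
      difference≈0 : ∀ {s t} → y s ≈ y t → eval (var s -ₚ var t) y ≈ 0#
      difference≈0 {s} {t} ys≈yt = ≈-trans (eval-var-var y s t) (x≈y⇒x∙y⁻¹≈ε ys≈yt)
      product≈0 : SomePair (λ s t → y s ≈ y t) a b c →
        (eval (var a -ₚ var b) y * eval (var a -ₚ var c) y) * eval (var b -ₚ var c) y ≈ 0#
      product≈0 (inj₁ ab)        = ≈-trans (*-congʳ (≈-trans (*-congʳ (difference≈0 ab)) (zeroˡ _))) (zeroˡ _)
      product≈0 (inj₂ (inj₁ ac)) = ≈-trans (*-congʳ (≈-trans (*-congˡ (difference≈0 ac)) (zeroʳ _))) (zeroˡ _)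
      product≈0 (inj₂ (inj₂ bc)) = ≈-trans (*-congˡ (difference≈0 bc)) (zeroʳ _)

  module _ (F : IsField R) where
    open IsField F

    *-nonzero : ∀ {a b} → ¬ a ≈ 0# → ¬ b ≈ 0# → ¬ a * b ≈ 0#
    *-nonzero {a} {b} a≉0 b≉0 ab≈0 with inverse a a≉0
    ... | a⁻¹ , aa⁻¹≈1 = b≉0 (begin
      b              ≈⟨ ≈-sym (*-identityˡ b) ⟩
      1# * b         ≈⟨ *-congʳ (≈-trans (≈-sym aa⁻¹≈1) (*-comm a a⁻¹)) ⟩
      (a⁻¹ * a) * b  ≈⟨ *-assoc a⁻¹ a b ⟩
      a⁻¹ * (a * b)  ≈⟨ *-congˡ ab≈0 ⟩
      a⁻¹ * 0#       ≈⟨ zeroʳ a⁻¹ ⟩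
      0#             ∎)
      where open ≈-Reasoning

    module _ {n} (y : Fin n → Carrier) where

      1ₚ-nonzero : ¬ eval {n} 1ₚ y ≈ 0#
      1ₚ-nonzero 1≈0 = 0≉1 (≈-sym (≈-trans (≈-sym (eval-1ₚ y)) 1≈0))

      ^ₚ-nonzero : ∀ {p : Pol n} → ¬ eval p y ≈ 0# → ∀ k → ¬ eval (p ^ₚ k) y ≈ 0#
      ^ₚ-nonzero p≉0 zero    = 1ₚ-nonzero
      ^ₚ-nonzero {p} p≉0 (suc k) pᵏ⁺¹≈0 =
        *-nonzero p≉0 (^ₚ-nonzero p≉0 k) (≈-trans (≈-sym (eval-*ₚ y p (p ^ₚ k))) pᵏ⁺¹≈0)

      prodₚ-nonzero : ∀ {ps : List (Pol n)} → All (λ p → ¬ eval p y ≈ 0#) ps → ¬ eval (prodₚ ps) y ≈ 0#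
      prodₚ-nonzero All.[]                    = 1ₚ-nonzero
      prodₚ-nonzero {p ∷ ps} (p≉0 All.∷ ps≉0) ∏≈0 =
        *-nonzero p≉0 (prodₚ-nonzero ps≉0) (≈-trans (≈-sym (eval-*ₚ y p (prodₚ ps))) ∏≈0)

  module _ (cz : CharZero R) where

    natCast-injective : ∀ {m k} → natCast R m ≈ natCast R k → m ≡ k
    natCast-injective {zero}  {zero}  _   = refl
    natCast-injective {zero}  {suc k} 0≈k = contradiction (≈-sym 0≈k) (cz k)
    natCast-injective {suc m} {zero}  m≈0 = contradiction m≈0 (cz m)
    natCast-injective {suc m} {suc k} m≈k = cong suc (natCast-injective (∙-cancelˡ 1# _ _ m≈k))

  ∸-injectiveˡ-above : ∀ {t a b} → t < a → a ∸ t ≡ b ∸ t → a ≡ b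
  ∸-injectiveˡ-above {t} {a} {b} t<a a∸t≡b∸t with t ℕ.≤? b
  ... | yes t≤b = ℕ.∸-cancelʳ-≡ (ℕ.<⇒≤ t<a) t≤b a∸t≡b∸t
  ... | no t≰b  =
    contradiction (ℕ.m∸n≡0⇒m≤n (≡.trans a∸t≡b∸t (ℕ.m≤n⇒m∸n≡0 (ℕ.<⇒≤ (ℕ.≰⇒> t≰b))))) (ℕ.<⇒≱ t<a)

  ramp : ∀ {n} → ℕ → Fin n → Carrier
  ramp t v = natCast R (toℕ v ∸ t)

  ramp-below : ∀ {n t} {v : Fin n} → toℕ v ≤ t → ramp t v ≈ 0#
  ramp-below v≤t = reflexive (cong (natCast R) (ℕ.m≤n⇒m∸n≡0 v≤t))

  ramp-separates : CharZero R → ∀ {n t} {a b : Fin n} → t < toℕ a → a ≢ b → ¬ ramp t a ≈ ramp t b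
  ramp-separates cz t<a a≢b ra≈rb = a≢b (Fin.toℕ-injective (∸-injectiveˡ-above t<a (natCast-injective cz ra≈rb)))

  -- Among three distinct vertices 0, …, t + 1 two lie in the flat part of the ramp.
  pG-zero-at-ramp : ∀ {n t} {G : ThreeGraph n} → 3 ≤ suc (suc t) → suc (suc t) ≤ n → IsPartite (suc t) G →
                    eval (pG G) (ramp t) ≈ 0#
  pG-zero-at-ramp {n} {t} 3≤l l≤n partite =
    eval-prodₚ-zero (ramp t) (missing-factor 3≤l partite ι (Fin.inject≤-injective l≤n l≤n)
      (somePair-symmetric₃ {S = λ s s′ → ramp t s ≈ ramp t s′} ≈-sym) two-flat
      (λ {a} {b} {c} _ _ → eval-factor-zero (ramp t) {a} {b} {c}))
    where
    ι : Fin (suc (suc t)) → Fin n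
    ι u = Fin.inject≤ u l≤n
    flat : ∀ u → toℕ u ≤ t → ramp t (ι u) ≈ 0#
    flat u u≤t = ramp-below (≡.subst (_≤ t) (≡.sym (Fin.toℕ-inject≤ u l≤n)) u≤t)
    top : ∀ {u v : Fin (suc (suc t))} → ¬ toℕ u ≤ t → ¬ toℕ v ≤ t → u ≡ v
    top u≰t v≰t = Fin.toℕ-injective (≡.trans (is-top u≰t) (≡.sym (is-top v≰t)))
      where
      is-top : ∀ {u : Fin (suc (suc t))} → ¬ toℕ u ≤ t → toℕ u ≡ suc t
      is-top {u} u≰t = ℕ.≤-antisym (ℕ.≤-pred (Fin.toℕ<n u)) (ℕ.≰⇒> u≰t)
    two-flat : ∀ {u v w} → u ≢ v → u ≢ w → v ≢ w → SomePair (λ s s′ → ramp t s ≈ ramp t s′) (ι u) (ι v) (ι w)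
    two-flat {u} {v} {w} u≢v u≢w v≢w with toℕ u ℕ.≤? t | toℕ v ℕ.≤? t | toℕ w ℕ.≤? t
    ... | yes u≤t | yes v≤t | _       = inj₁ (≈-trans (flat u u≤t) (≈-sym (flat v v≤t)))
    ... | yes u≤t | _       | yes w≤t = inj₂ (inj₁ (≈-trans (flat u u≤t) (≈-sym (flat w w≤t))))
    ... | _       | yes v≤t | yes w≤t = inj₂ (inj₂ (≈-trans (flat v v≤t) (≈-sym (flat w w≤t))))
    ... | no u≰t  | no v≰t  | _       = contradiction (top u≰t v≰t) u≢v
    ... | no u≰t  | _       | no w≰t  = contradiction (top u≰t w≰t) u≢w
    ... | _       | no v≰t  | no w≰t  = contradiction (top v≰t w≰t) v≢w

  SeparatedPair : ∀ {n} → ℕ → Fin n × Fin n → Set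
  SeparatedPair m (a , b) = m ≤ toℕ a × a ≢ b

  separatedPair? : ∀ {n} m → Decidable (SeparatedPair {n} m)
  separatedPair? m (a , b) = m ℕ.≤? toℕ a ×-dec ¬? (a Fin.≟ b)

  separatedPairs : (n m : ℕ) → List (Fin n × Fin n)
  separatedPairs n m = filter (separatedPair? m) (cartesianProduct (allFin n) (allFin n))

  separatorFactor : ∀ {n} → ℕ → Fin n × Fin n → Pol n
  separatorFactor k (a , b) = (var a -ₚ var b) ^ₚ k

  separator : (n l : ℕ) → Pol n
  separator n l = prodₚ (List.map (separatorFactor (n ∸ 2)) (separatedPairs n (l ∸ 1)))

  injection-unbounded : ∀ {m n} (ι : Fin (suc m) → Fin n) → Injective ι → ¬ (∀ u → toℕ (ι u) < m)
  injection-unbounded {m} ι ι-inj small with Fin.pigeonhole (ℕ.n<1+n m) (λ u → Fin.fromℕ< (small u))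
  ... | u , v , u<v , same = contradiction (ι-inj u v (Fin.toℕ-injective toℕ-same)) (Fin.<⇒≢ u<v)
    where
    toℕ-same : toℕ (ι u) ≡ toℕ (ι v)
    toℕ-same = ≡.trans (≡.sym (Fin.toℕ-fromℕ< (small u))) (≡.trans (cong toℕ same) (Fin.toℕ-fromℕ< (small v)))

  large-image : ∀ {m n} (ι : Fin (suc m) → Fin n) → Injective ι → ∃ λ u → m ≤ toℕ (ι u)
  large-image {m} ι ι-inj with Fin.any? (λ u → m ℕ.≤? toℕ (ι u))
  ... | yes large = large
  ... | no none   = contradiction (λ u → ℕ.≰⇒> (λ m≤ιu → none (u , m≤ιu))) (injection-unbounded ι ι-inj)

  separator∈DI : ∀ {n l} → 3 ≤ l → DI n l (separator n l)
  separator∈DI {n} {suc m} 3≤l i j j+3≤n ι ι-inj x x-diag with large-image ι ι-inj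
  ... | u , m≤ιu = vanishes-prodₚ i x (lose (∈-map⁺ (separatorFactor (n ∸ 2)) separated) factor-vanishes) j j<n∸2
    where
    v : Fin (suc m)
    v = proj₁ (third 3≤l u u)
    separated : (ι u , ι v) ∈ separatedPairs n m
    separated = ∈-filter⁺ (separatedPair? m) (∈-cartesianProduct⁺ (∈-allFin (ι u)) (∈-allFin (ι v)))
                  (m≤ιu , injective-≢ ι-inj (proj₁ (proj₂ (third 3≤l u u)) ∘ ≡.sym))
    factor-vanishes : Vanishes i x (n ∸ 2) (separatorFactor (n ∸ 2) (ι u , ι v))
    factor-vanishes = vanishes-^ₚ i x (var (ι u) -ₚ var (ι v)) (n ∸ 2) (vanishes-var-var i x (x-diag u v))
    j<n∸2 : j < n ∸ 2
    j<n∸2 = ℕ.m+n≤o⇒m≤o∸n (suc j) (≡.subst (_≤ n) (ℕ.+-suc j 2) j+3≤n)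

  separator-nonzero : IsField R → CharZero R → ∀ {n t} → ¬ eval (separator n (suc (suc t))) (ramp t) ≈ 0#
  separator-nonzero F cz {n} {t} = prodₚ-nonzero F (ramp t) (All.map⁺ (All.tabulate factor-nonzero))
    where
    factor-nonzero : ∀ {ab} → ab ∈ separatedPairs n (suc t) → ¬ eval (separatorFactor (n ∸ 2) ab) (ramp t) ≈ 0#
    factor-nonzero {a , b} ab∈ with ∈-filter⁻ (separatedPair? (suc t)) {xs = cartesianProduct (allFin n) (allFin n)} ab∈
    ... | _ , t<a , a≢b = ^ₚ-nonzero F (ramp t) difference-nonzero (n ∸ 2)
      where
      difference-nonzero : ¬ eval (var a -ₚ var b) (ramp t) ≈ 0#
      difference-nonzero difference≈0 = ramp-separates cz t<a a≢b
        (x∙y⁻¹≈ε⇒x≈y _ _ (≈-trans (≈-sym (eval-var-var (ramp t) a b)) difference≈0))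

  separator∉Phat : IsField R → CharZero R → ∀ {n l} → 3 ≤ l → l ≤ n → ¬ Phat n l (separator n l)
  separator∉Phat F cz {l = suc zero} (s≤s ())
  separator∉Phat F cz {n} {suc (suc t)} 3≤l l≤n separator∈Phat = separator-nonzero F cz {n} {t}
    (≈-trans (eval-cong (ramp t) (Phat⇒≋ {l = suc (suc t)} {separator n (suc (suc t))} separator∈Phat))
      (eval-sumₚ-zero (ramp t) {ps = combinationTerms (proj₁ separator∈Phat)}
        (All.map⁺ (All.universal term-zero (proj₁ separator∈Phat)))))
    where
    term-zero : ∀ (y : Pol n × PartiteGraph n (suc t)) → eval (proj₁ y *ₚ pG (proj₁ (proj₂ y))) (ramp t) ≈ 0#
    term-zero (a , G , partite) =
      ≈-trans (eval-*ₚ (ramp t) a (pG G)) (≈-trans (*-congˡ (pG-zero-at-ramp 3≤l l≤n partite)) (zeroʳ _))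

  -- Fewer than ℓ variables

  complete : ∀ {n} → ThreeGraph n
  complete = record { edge = λ _ _ _ → true }

  pG-complete : ∀ {n} → pG (complete {n}) ≡ 1ₚ
  pG-complete {n} = cong prodₚ (no-factors (triples n))
    where
    no-factors : ∀ (ts : List (Triple n)) → concatMap (proj₁ (factorSelection complete)) ts ≡ []
    no-factors []       = refl
    no-factors (_ ∷ ts) = no-factors ts

  complete-partite : ∀ {n m} → n ≤ m → IsPartite m (complete {n})
  complete-partite {n} {m} n≤m =
    colour , λ a b c a<b b<c _ → distinct a<b , distinct (Fin.<-trans a<b b<c) , distinct b<c
    where
    colour : Fin n → Fin m
    colour v = Fin.inject≤ v n≤m
    distinct : ∀ {a b} → a Fin.< b → colour a ≢ colour b
    distinct a<b same = Fin.<⇒≢ a<b (Fin.inject≤-injective n≤m n≤m _ _ same)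

  Phat-total : ∀ {n l} → n < l → (p : Pol n) → Phat n l p
  Phat-total {l = suc m} (s≤s n≤m) p = [ (p , complete , complete-partite n≤m) ] , pointwise (≋-sym (begin
    p *ₚ pG complete ++ [] ≡⟨ List.++-identityʳ _ ⟩
    p *ₚ pG complete       ≡⟨ cong (p *ₚ_) pG-complete ⟩
    p *ₚ 1ₚ                ≈⟨ *ₚ-1ₚ p ⟩
    p                      ∎))
    where open ≋-Reasoning

  DI-total : ∀ {n l} → n < l → (p : Pol n) → DI n l p
  DI-total n<l p i j _ ι ι-inj with Fin.pigeonhole n<l ι
  ... | u , v , u<v , same = contradiction (ι-inj u v same) (Fin.<⇒≢ u<v)

theorem1p1 : {c ℓ : Level} (R : CommutativeRing c ℓ) → IsField R → CharZero R →
    (l : ℕ) → 3 ≤ l →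
      ((n : ℕ) → l ≤ n →
          ((p : Poly.Pol R n) → Poly.Phat R n l p → Poly.DI R n l p)
        × Σ (Poly.Pol R n) (λ p → Poly.DI R n l p × ¬ Poly.Phat R n l p))
    × ((n : ℕ) → n < l →
          ((p : Poly.Pol R n) → Poly.Phat R n l p)
        × ((p : Poly.Pol R n) → Poly.DI R n l p))
theorem1p1 R F cz l 3≤l =
    (λ n l≤n → Phat⊆DI R 3≤l , separator R n l , separator∈DI R 3≤l , separator∉Phat R F cz 3≤l l≤n)
  , (λ n n<l → Phat-total R n<l , DI-total R n<l)
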